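{- Let $S$ be a finite sequence of variables and $k\ge 0$. (1) If $A \Rightarrow_{S,k} B$ for labeled terms $A,B$, then there exist variables $x_1,\dots,x_k$, labels $a_1,\dots,a_k$ and a labeled term $B'$ with $B = \lambda^{a_1}x_1.\cdots\lambda^{a_k}x_k.B'$. (2) If $A\Rightarrow_{S,k}B$, then $|A| \Rrightarrow_{S,k} |B|$. (3) If $M\Rrightarrow_{S,k}N$ for unlabeled terms $M,N$, then there exist a labeling $M_\ell$ of $M$ and a labeling $N_\ell$ of $N$ with $M_\ell \Rightarrow_{S,k} N_\ell$.
   Context: Unlabeled terms: $M ::= x \mid M\,M\mid\lambda x.M$. Labeled terms: $A ::= x \mid \lambda^a x.A \mid A\,@^a A$ with labels from a countably infinite set containing a distinguished never-bound label $\star$; in $A\,@^a B$ the label $a$ binds the occurrences of $a$ in $A$. Terms are up to renaming of bound variables/labels. $A[x:=B]$ is substitution capturing neither variables nor labels; $A[a:=\star]$ replaces free occurrences of $a$ by $\star$. $|A|$ erases labels ($|A\,@^aB|=|A|\,|B|$); $A$ is a labeling of $M$ if $|A|=M$. A term is away from a sequence $S$ if none of its free variables occur in $S$; $x\cdot S$ prepends $x$ to $S$. Unlabeled superstep $\Rrightarrow_{S,k}$: $x\Rrightarrow_{S,0}x$; $M\Rrightarrow_{x\cdot S,0}M'$ gives $\lambda x.M\Rrightarrow_{S,0}\lambda x.M'$; $M\Rrightarrow_{S,k}M'$ gives $\lambda x.M\Rrightarrow_{S,k+1}\lambda x.M'$; $M\Rrightarrow_{S,0}M'$ and $N\Rrightarrow_{S,0}N'$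 give $MN\Rrightarrow_{S,0}M'N'$; if $M\Rrightarrow_{S,n+1}\lambda x.M'$, $N\Rrightarrow_{S,m}N'$, $(\lambda x.M')N'$ is away from $S$ and ($m>0\Rightarrow M'=\lambda x_1\dots x_n.x$) then $MN\Rrightarrow_{S,n+m}M'[x:=N']$. Labeled superstep $\Rightarrow_{S,k}$: $x\Rightarrow_{S,0}x$; $A\Rightarrow_{x\cdot S,0}A'$ gives $\lambda^a x.A\Rightarrow_{S,0}\lambda^a x.A'$; $A\Rightarrow_{S,k}A'$ gives $\lambda^a x.A\Rightarrow_{S,k+1}\lambda^a x.A'$; $A\Rightarrow_{S,0}A'$ and $B\Rightarrow_{S,0}B'$ give $A\,@^aB\Rightarrow_{S,0}A'\,@^aB'$; if $A\Rightarrow_{S,n+1}\lambda^a x.A'$, $B\Rightarrow_{S,m}B'$, $(\lambda^a x.A')\,@^a B'$ is away from $S$, and ($m>0\Rightarrow A'=\lambda^{a_1\dots a_n}x_1\dots x_n.x$) then $A\,@^aB\Rightarrow_{S,n+m}A'[a:=\star][x:=B']$. -}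

module Defs where

open import Data.Nat using (ℕ; zero; suc; _+_; _<_)
open import Data.List using (List; []; _∷_; map)
open import Data.List.Membership.Propositional using (_∈_)
open import Data.Vec using (Vec; []; _∷_)
open import Data.Sum using (_⊎_)
open import Data.Product using (∃; ∃-syntax; _×_)
open import Relation.Nullary using (¬_)
open import Relation.Binary.PropositionalEquality using (_≡_)

-- Terms up to renaming of bound variables/labels are represented with
-- de Bruijn indices (variables) and de Bruijn indices for labels.

data Tm : Set where
  var : ℕ → Tm
  app : Tm → Tm → Tm
  lam : Tm → Tm

-- variable sequence S (as free de Bruijn indices)
-- x · S   (x the variable bound by the enclosing λ)
_·S : List ℕ → List ℕ
S ·S = 0 ∷ map suc S

↑S : List ℕ → List ℕ
↑S S = map suc S

ext : (ℕ → ℕ) → ℕ → ℕ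
ext ρ zero    = zero
ext ρ (suc i) = suc (ρ i)

rename : (ℕ → ℕ) → Tm → Tm
rename ρ (var x)   = var (ρ x)
rename ρ (app M N) = app (rename ρ M) (rename ρ N)
rename ρ (lam M)   = lam (rename (ext ρ) M)

exts : (ℕ → Tm) → ℕ → Tm
exts σ zero    = var zero
exts σ (suc i) = rename suc (σ i)

subst : (ℕ → Tm) → Tm → Tm
subst σ (var x)   = σ x
subst σ (app M N) = app (subst σ M) (subst σ N)
subst σ (lam M)   = lam (subst (exts σ) M)

single : Tm → ℕ → Tm
single N zero    = N
single N (suc i) = var i

-- M [ N ] : M lives under one binder x; result is M[x:=N]
_[_] : Tm → Tm → Tm
M [ N ] = subst (single N) M

data Free : ℕ → Tm → Set where
  fvar  : ∀ {x} → Free x (var x)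
  fappl : ∀ {x M N} → Free x M → Free x (app M N)
  fappr : ∀ {x M N} → Free x N → Free x (app M N)
  flam  : ∀ {x M} → Free (suc x) M → Free x (lam M)

Away : List ℕ → Tm → Set
Away S M = ∀ x → Free x M → ¬ (x ∈ S)

lams : ℕ → Tm → Tm
lams zero    M = M
lams (suc n) M = lam (lams n M)

data _⇛[_,_]_ : Tm → List ℕ → ℕ → Tm → Set where
  ⇛var  : ∀ {S x} → var x ⇛[ S , 0 ] var x
  ⇛lam0 : ∀ {S M M'} → M ⇛[ S ·S , 0 ] M' → lam M ⇛[ S , 0 ] lam M'
  ⇛lamS : ∀ {S k M M'} → M ⇛[ ↑S S , k ] M' → lam M ⇛[ S , suc k ] lam M'
  ⇛app  : ∀ {S M M' N N'} → M ⇛[ S , 0 ] M' → N ⇛[ S , 0 ] N' →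
          app M N ⇛[ S , 0 ] app M' N'
  ⇛β    : ∀ {S n m M M' N N'} →
          M ⇛[ S , suc n ] lam M' → N ⇛[ S , m ] N' →
          Away S (app (lam M') N') →
          (0 < m → M' ≡ lams n (var n)) →
          app M N ⇛[ S , n + m ] (M' [ N' ])

-- Labeled terms  A ::= x | λ^a x.A | A @^a A
-- A label is ⋆ (never bound) or a de Bruijn label index; in A @ B
-- (constructor lapp) the application binds label index 0 in A.

data Label : Set where
  ⋆   : Label
  lab : ℕ → Label

data LTm : Set where
  var  : ℕ → LTm
  llam : Label → LTm → LTm
  lapp : LTm → LTm → LTm

mapLabel : (ℕ → Label) → Label → Label
mapLabel τ ⋆       = ⋆
mapLabel τ (lab a) = τ a

shiftLabel : Label → Label
shiftLabel ⋆       = ⋆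
shiftLabel (lab a) = lab (suc a)

lext : (ℕ → Label) → ℕ → Label
lext τ zero    = lab zero
lext τ (suc a) = shiftLabel (τ a)

lsub : (ℕ → Label) → LTm → LTm
lsub τ (var x)    = var x
lsub τ (llam l A) = llam (mapLabel τ l) (lsub τ A)
lsub τ (lapp A B) = lapp (lsub (lext τ) A) (lsub τ B)

-- A [a:=⋆] for a the label bound by the enclosing application
starSub : ℕ → Label
starSub zero    = ⋆
starSub (suc a) = lab a

_[⋆] : LTm → LTm
A [⋆] = lsub starSub A

lshift : LTm → LTm
lshift = lsub (λ a → lab (suc a))

lrename : (ℕ → ℕ) → LTm → LTm
lrename ρ (var x)    = var (ρ x)
lrename ρ (llam l A) = llam l (lrename (ext ρ) A)
lrename ρ (lapp A B) = lapp (lrename ρ A) (lrename ρ B)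

lexts : (ℕ → LTm) → ℕ → LTm
lexts σ zero    = var zero
lexts σ (suc i) = lrename suc (σ i)

-- capture-avoiding for both variables and labels
lsubst : (ℕ → LTm) → LTm → LTm
lsubst σ (var x)    = σ x
lsubst σ (llam l A) = llam l (lsubst (lexts σ) A)
lsubst σ (lapp A B) = lapp (lsubst (λ i → lshift (σ i)) A) (lsubst σ B)

lsingle : LTm → ℕ → LTm
lsingle B zero    = B
lsingle B (suc i) = var i

_⟦_⟧ : LTm → LTm → LTm
A ⟦ B ⟧ = lsubst (lsingle B) A

data LFree : ℕ → LTm → Set where
  fvar  : ∀ {x} → LFree x (var x)
  fappl : ∀ {x A B} → LFree x A → LFree x (lapp A B)
  fappr : ∀ {x A B} → LFree x B → LFree x (lapp A B)
  flam  : ∀ {x l A} → LFree (suc x) A → LFree x (llam l A)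

LAway : List ℕ → LTm → Set
LAway S A = ∀ x → LFree x A → ¬ (x ∈ S)

llams : ∀ {n} → Vec Label n → LTm → LTm
llams []       A = A
llams (l ∷ ls) A = llam l (llams ls A)

data _⇒[_,_]_ : LTm → List ℕ → ℕ → LTm → Set where
  ⇒var  : ∀ {S x} → var x ⇒[ S , 0 ] var x
  ⇒lam0 : ∀ {S l A A'} → A ⇒[ S ·S , 0 ] A' → llam l A ⇒[ S , 0 ] llam l A'
  ⇒lamS : ∀ {S k l A A'} → A ⇒[ ↑S S , k ] A' →
          llam l A ⇒[ S , suc k ] llam l A'
  ⇒app  : ∀ {S A A' B B'} → A ⇒[ S , 0 ] A' → B ⇒[ S , 0 ] B' →
          lapp A B ⇒[ S , 0 ] lapp A' B'
  ⇒β    : ∀ {S n m A A' B B'} →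
          A ⇒[ S , suc n ] llam (lab 0) A' → B ⇒[ S , m ] B' →
          LAway S (lapp (llam (lab 0) A') B') →
          (0 < m → ∃[ ls ] A' ≡ llams {n} ls (var n)) →
          lapp A B ⇒[ S , n + m ] ((A' [⋆]) ⟦ B' ⟧)

erase : LTm → Tm
erase (var x)    = var x
erase (llam l A) = lam (erase A)
erase (lapp A B) = app (erase A) (erase B)

-- Erasure commutes with the labeled contraction (A[a:=⋆])[x:=B], and the
-- free variables of a labeled term are those of its erasure, so every rule
-- of the labeled superstep erases to the same rule of the unlabeled one.
-- Conversely an unlabeled derivation is labeled rule by rule; the only
-- constraint is in the β-rule, where the function part must reduce to a
-- λ carrying exactly the label bound by the application. This is met by
-- labeling with an invariant: for any prescribed labels a₁…a_k, the target
-- of the labeled superstep is λ^{a₁}…λ^{a_k}.E. Both that invariant and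
-- part (1) rest on one computation: the contractum of a β-step keeps the
-- λ-prefix of the function body, followed (when m > 0, i.e. the body is a
-- projection λx₁…xₙ.x) by the λ-prefix of the argument.
module Submission where

open import Defs
open import Data.Nat using (ℕ; zero; suc; _+_; _<_; s≤s; z≤n)
open import Data.Nat.Properties using (+-identityʳ; +-suc)
open import Data.List using (List)
open import Data.Vec using (Vec; []; _∷_; _++_; replicate; splitAt)
import Data.Vec as Vec
open import Data.Product using (∃; ∃-syntax; _×_; _,_)
open import Relation.Binary.PropositionalEquality
  using (_≡_; refl; sym; trans; cong; cong₂; module ≡-Reasoning)
import Relation.Binary.PropositionalEquality as Eq

rename-cong : ∀ {ρ ρ' : ℕ → ℕ} → (∀ i → ρ i ≡ ρ' i) → ∀ M → rename ρ M ≡ rename ρ' M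
rename-cong h (var x)   = cong var (h x)
rename-cong h (app M N) = cong₂ app (rename-cong h M) (rename-cong h N)
rename-cong h (lam M)   = cong lam (rename-cong ext-cong M)
  where
  ext-cong : ∀ i → ext _ i ≡ ext _ i
  ext-cong zero    = refl
  ext-cong (suc i) = cong suc (h i)

subst-cong : ∀ {σ σ' : ℕ → Tm} → (∀ i → σ i ≡ σ' i) → ∀ M → subst σ M ≡ subst σ' M
subst-cong h (var x)   = h x
subst-cong h (app M N) = cong₂ app (subst-cong h M) (subst-cong h N)
subst-cong h (lam M)   = cong lam (subst-cong exts-cong M)
  where
  exts-cong : ∀ i → exts _ i ≡ exts _ i
  exts-cong zero    = refl
  exts-cong (suc i) = cong (rename suc) (h i)

lam-injective : ∀ {M N} → lam M ≡ lam N → M ≡ N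
lam-injective refl = refl

lams-injective : ∀ n {M N} → lams n M ≡ lams n N → M ≡ N
lams-injective zero    eq = eq
lams-injective (suc n) eq = lams-injective n (lam-injective eq)

llam-injective : ∀ {l l' A B} → llam l A ≡ llam l' B → A ≡ B
llam-injective refl = refl

erase-lsub : ∀ τ A → erase (lsub τ A) ≡ erase A
erase-lsub τ (var x)    = refl
erase-lsub τ (llam l A) = cong lam (erase-lsub τ A)
erase-lsub τ (lapp A B) = cong₂ app (erase-lsub (lext τ) A) (erase-lsub τ B)

erase-lrename : ∀ ρ A → erase (lrename ρ A) ≡ rename ρ (erase A)
erase-lrename ρ (var x)    = refl
erase-lrename ρ (llam l A) = cong lam (erase-lrename (ext ρ) A)
erase-lrename ρ (lapp A B) = cong₂ app (erase-lrename ρ A) (erase-lrename ρ B)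

erase-lsubst : ∀ σ A → erase (lsubst σ A) ≡ subst (λ i → erase (σ i)) (erase A)
erase-lsubst σ (var x)    = refl
erase-lsubst σ (llam l A) =
  cong lam (trans (erase-lsubst (lexts σ) A) (subst-cong erase-lexts (erase A)))
  where
  erase-lexts : ∀ i → erase (lexts σ i) ≡ exts (λ j → erase (σ j)) i
  erase-lexts zero    = refl
  erase-lexts (suc i) = erase-lrename suc (σ i)
erase-lsubst σ (lapp A B) =
  cong₂ app (trans (erase-lsubst (λ i → lshift (σ i)) A)
                   (subst-cong (λ i → erase-lsub _ (σ i)) (erase A)))
            (erase-lsubst σ B)

erase-contractum : ∀ A B → erase ((A [⋆]) ⟦ B ⟧) ≡ erase A [ erase B ]
erase-contractum A B = begin
  erase ((A [⋆]) ⟦ B ⟧)                             ≡⟨ erase-lsubst (lsingle B) (A [⋆]) ⟩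
  subst (λ i → erase (lsingle B i)) (erase (A [⋆])) ≡⟨ subst-cong erase-lsingle (erase (A [⋆])) ⟩
  erase (A [⋆]) [ erase B ]                         ≡⟨ cong (_[ erase B ]) (erase-lsub starSub A) ⟩
  erase A [ erase B ]                               ∎
  where
  open ≡-Reasoning
  erase-lsingle : ∀ i → erase (lsingle B i) ≡ single (erase B) i
  erase-lsingle zero    = refl
  erase-lsingle (suc i) = refl

erase-llams : ∀ {n} (ls : Vec Label n) A → erase (llams ls A) ≡ lams n (erase A)
erase-llams []       A = refl
erase-llams (l ∷ ls) A = cong lam (erase-llams ls A)

erase≡var : ∀ A {x} → erase A ≡ var x → A ≡ var x
erase≡var (var y)    refl = refl
erase≡var (llam _ _) ()
erase≡var (lapp _ _) ()

erase-llams≡projection : ∀ {n} (ls : Vec Label n) A →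
  erase (llams ls A) ≡ lams n (var n) → A ≡ var n
erase-llams≡projection {n} ls A eq =
  erase≡var A (lams-injective n (trans (sym (erase-llams ls A)) eq))

LFree⇒Free : ∀ {x A} → LFree x A → Free x (erase A)
LFree⇒Free fvar      = fvar
LFree⇒Free (fappl p) = fappl (LFree⇒Free p)
LFree⇒Free (fappr p) = fappr (LFree⇒Free p)
LFree⇒Free (flam p)  = flam (LFree⇒Free p)

Free⇒LFree : ∀ {x} A → Free x (erase A) → LFree x A
Free⇒LFree (var y)    fvar      = fvar
Free⇒LFree (llam l A) (flam p)  = flam (Free⇒LFree A p)
Free⇒LFree (lapp A B) (fappl p) = fappl (Free⇒LFree A p)
Free⇒LFree (lapp A B) (fappr p) = fappr (Free⇒LFree B p)

Away⇒LAway : ∀ {S} A → Away S (erase A) → LAway S A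
Away⇒LAway A away x p = away x (LFree⇒Free p)

LAway⇒Away : ∀ {S} A → LAway S A → Away S (erase A)
LAway⇒Away A away x p = away x (Free⇒LFree A p)

LamPrefix : ∀ {n} → Vec Label n → LTm → Set
LamPrefix ls A = ∃[ E ] A ≡ llams ls E

llams-++ : ∀ {n m} (xs : Vec Label n) (ys : Vec Label m) E →
  llams (xs ++ ys) E ≡ llams xs (llams ys E)
llams-++ []       ys E = refl
llams-++ (x ∷ xs) ys E = cong (llam x) (llams-++ xs ys E)

llams-LamPrefix : ∀ {n m} (xs : Vec Label n) {ys : Vec Label m} {A} →
  LamPrefix ys A → LamPrefix (xs ++ ys) (llams xs A)
llams-LamPrefix xs {ys} (E , refl) = E , sym (llams-++ xs ys E)

lsub-llams : ∀ τ {n} (ls : Vec Label n) A →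
  lsub τ (llams ls A) ≡ llams (Vec.map (mapLabel τ) ls) (lsub τ A)
lsub-llams τ []       A = refl
lsub-llams τ (l ∷ ls) A = cong (llam _) (lsub-llams τ ls A)

extN : ℕ → (ℕ → ℕ) → ℕ → ℕ
extN zero    ρ = ρ
extN (suc n) ρ = extN n (ext ρ)

lrename-llams : ∀ ρ {n} (ls : Vec Label n) A →
  lrename ρ (llams ls A) ≡ llams ls (lrename (extN n ρ) A)
lrename-llams ρ []       A = refl
lrename-llams ρ (l ∷ ls) A = cong (llam l) (lrename-llams (ext ρ) ls A)

lrename-LamPrefix : ∀ {m} {ls : Vec Label m} ρ {A} →
  LamPrefix ls A → LamPrefix ls (lrename ρ A)
lrename-LamPrefix {m} {ls} ρ (E , refl) = lrename (extN m ρ) E , lrename-llams ρ ls E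

lextsN : ℕ → (ℕ → LTm) → ℕ → LTm
lextsN zero    σ = σ
lextsN (suc n) σ = lextsN n (lexts σ)

lsubst-llams : ∀ σ {n} (ls : Vec Label n) A →
  lsubst σ (llams ls A) ≡ llams ls (lsubst (lextsN n σ) A)
lsubst-llams σ []       A = refl
lsubst-llams σ (l ∷ ls) A = cong (llam l) (lsubst-llams (lexts σ) ls A)

lextsN-LamPrefix : ∀ {m} {ls : Vec Label m} n i σ →
  LamPrefix ls (σ i) → LamPrefix ls (lextsN n σ (n + i))
lextsN-LamPrefix zero    i σ p = p
lextsN-LamPrefix (suc n) i σ p rewrite sym (+-suc n i) =
  lextsN-LamPrefix n (suc i) (lexts σ) (lrename-LamPrefix suc p)

contractum-llams : ∀ {n} (ls : Vec Label n) C B →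
  (llams ls C [⋆]) ⟦ B ⟧
    ≡ llams (Vec.map (mapLabel starSub) ls) (lsubst (lextsN n (lsingle B)) (C [⋆]))
contractum-llams ls C B =
  trans (cong (lsubst (lsingle B)) (lsub-llams starSub ls C))
        (lsubst-llams (lsingle B) (Vec.map (mapLabel starSub) ls) (C [⋆]))

contractum-LamPrefix : ∀ {n m} (ls : Vec Label n) {ls₂ : Vec Label m} C B →
  LamPrefix ls₂ B → (0 < m → C ≡ var n) →
  LamPrefix (Vec.map (mapLabel starSub) ls ++ ls₂) ((llams ls C [⋆]) ⟦ B ⟧)
contractum-LamPrefix {m = zero} ls {[]} C B _ _
  rewrite contractum-llams ls C B = llams-LamPrefix (Vec.map (mapLabel starSub) ls) (_ , refl)
contractum-LamPrefix {n} {suc m} ls C B p projection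
  rewrite projection (s≤s z≤n) | contractum-llams ls (var n) B =
  llams-LamPrefix (Vec.map (mapLabel starSub) ls) body-LamPrefix
  where
  body-LamPrefix : LamPrefix _ (lextsN n (lsingle B) n)
  body-LamPrefix = Eq.subst (λ j → LamPrefix _ (lextsN n (lsingle B) j))
                            (+-identityʳ n) (lextsN-LamPrefix n 0 (lsingle B) p)

starSub-shiftLabel : ∀ {n} (ls : Vec Label n) →
  Vec.map (mapLabel starSub) (Vec.map shiftLabel ls) ≡ ls
starSub-shiftLabel []           = refl
starSub-shiftLabel (⋆ ∷ ls)     = cong (⋆ ∷_) (starSub-shiftLabel ls)
starSub-shiftLabel (lab a ∷ ls) = cong (lab a ∷_) (starSub-shiftLabel ls)

⇒-LamPrefix : ∀ {S k A B} → A ⇒[ S , k ] B → ∃[ ls ] LamPrefix {k} ls B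
⇒-LamPrefix (⇒var {x = x}) = [] , var x , refl
⇒-LamPrefix (⇒lam0 {l = l} {A' = A'} _) = [] , llam l A' , refl
⇒-LamPrefix (⇒lamS {l = l} d) with ⇒-LamPrefix d
... | ls , E , eq = l ∷ ls , E , cong (llam l) eq
⇒-LamPrefix (⇒app {A' = A'} {B' = B'} _ _) = [] , lapp A' B' , refl
⇒-LamPrefix (⇒β {m = zero} {B' = B'} d _ _ _) with ⇒-LamPrefix d
... | l ∷ ls , E , eq rewrite llam-injective eq =
  _ , contractum-LamPrefix ls {[]} E B' (B' , refl) λ ()
⇒-LamPrefix (⇒β {m = suc m} {B' = B'} _ e _ projection)
  with projection (s≤s z≤n) | ⇒-LamPrefix e
... | ls , refl | _ , p = _ , contractum-LamPrefix ls _ B' p λ _ → refl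

erase-⇒ : ∀ {S k A B} → A ⇒[ S , k ] B → erase A ⇛[ S , k ] erase B
erase-⇒ ⇒var        = ⇛var
erase-⇒ (⇒lam0 d)   = ⇛lam0 (erase-⇒ d)
erase-⇒ (⇒lamS d)   = ⇛lamS (erase-⇒ d)
erase-⇒ (⇒app d e)  = ⇛app (erase-⇒ d) (erase-⇒ e)
erase-⇒ {S} (⇒β {n = n} {m} {A} {A'} {B} {B'} d e away projection) =
  Eq.subst (app (erase A) (erase B) ⇛[ S , n + m ]_) (sym (erase-contractum A' B'))
    (⇛β (erase-⇒ d) (erase-⇒ e) (LAway⇒Away (lapp (llam (lab 0) A') B') away) erased-projection)
  where
  erased-projection : 0 < m → erase A' ≡ lams n (var n)
  erased-projection p with projection p
  ... | ls , eq = trans (cong erase eq) (erase-llams ls (var n))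

record Labeling (S : List ℕ) (k : ℕ) (M N : Tm) (ls : Vec Label k) : Set where
  constructor labeling
  field
    {source target} : LTm
    erase-source : erase source ≡ M
    erase-target : erase target ≡ N
    step         : source ⇒[ S , k ] target
    prefix       : LamPrefix ls target

-- The function part is labeled with the label bound by the application in
-- front of the shifted labels ls₁, which [a:=⋆] turns back into ls₁.
label-⇛ : ∀ {S k M N} → M ⇛[ S , k ] N → (ls : Vec Label k) → Labeling S k M N ls
label-⇛ (⇛var {x = x}) [] = labeling refl refl ⇒var (var x , refl)
label-⇛ (⇛lam0 d) [] with label-⇛ d []
... | labeling e₁ e₂ st _ = labeling (cong lam e₁) (cong lam e₂) (⇒lam0 {l = ⋆} st) (_ , refl)
label-⇛ (⇛lamS d) (l ∷ ls) with label-⇛ d ls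
... | labeling e₁ e₂ st (E , eq) =
  labeling (cong lam e₁) (cong lam e₂) (⇒lamS st) (E , cong (llam l) eq)
label-⇛ (⇛app d e) [] with label-⇛ d [] | label-⇛ e []
... | labeling e₁ e₂ st _ | labeling f₁ f₂ st′ _ =
  labeling (cong₂ app e₁ f₁) (cong₂ app e₂ f₂) (⇒app st st′) (_ , refl)
label-⇛ (⇛β {n = n} {m} dM dN away projection) ls with splitAt n ls
... | ls₁ , ls₂ , refl
  with label-⇛ dM (lab 0 ∷ Vec.map shiftLabel ls₁) | label-⇛ dN ls₂
... | labeling {A} refl e₂ st (C , refl) | labeling {B} {B'} refl refl st′ p
  with lam-injective e₂
... | refl =
  labeling refl (erase-contractum A' B')
    (⇒β st st′ (Away⇒LAway (lapp (llam (lab 0) A') B') away) labeled-projection)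
    (Eq.subst (λ ls' → LamPrefix (ls' ++ ls₂) ((A' [⋆]) ⟦ B' ⟧)) (starSub-shiftLabel ls₁)
      (contractum-LamPrefix shifted C B' p body-projection))
  where
  shifted = Vec.map shiftLabel ls₁
  A' = llams shifted C
  body-projection : 0 < m → C ≡ var n
  body-projection q = erase-llams≡projection shifted C (projection q)
  labeled-projection : 0 < m → ∃[ ls' ] A' ≡ llams ls' (var n)
  labeled-projection q = shifted , cong (llams shifted) (body-projection q)

mainTheorem6 : (S : List ℕ) (k : ℕ) →
    ((A B : LTm) → A ⇒[ S , k ] B →
       ∃[ ls ] ∃[ B' ] B ≡ llams {k} ls B')
    × ((A B : LTm) → A ⇒[ S , k ] B → erase A ⇛[ S , k ] erase B)
    × ((M N : Tm) → M ⇛[ S , k ] N →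
       ∃[ Mℓ ] ∃[ Nℓ ] (erase Mℓ ≡ M × erase Nℓ ≡ N × Mℓ ⇒[ S , k ] Nℓ))
mainTheorem6 S k = (λ _ _ → ⇒-LamPrefix) , (λ _ _ → erase-⇒) , labeled
  where
  labeled : (M N : Tm) → M ⇛[ S , k ] N →
    ∃[ Mℓ ] ∃[ Nℓ ] (erase Mℓ ≡ M × erase Nℓ ≡ N × Mℓ ⇒[ S , k ] Nℓ)
  labeled _ _ d = let open Labeling (label-⇛ d (replicate k ⋆))
                  in source , target , erase-source , erase-target , step
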